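{- Let $\mathcal{G}$ be a finite simple undirected connected graph and let $H_1$, $H_2$ be F-twin induced subgraphs of $\mathcal{G}$ with disjoint vertex sets, with $\varphi:V(H_1)\to V(H_2)$ an isomorphism witnessing the F-twin relation. Let $u\in V(H_1)$ and let $\tilde u$ be any other vertex of $\mathcal{G}$. Then: (a) if $\tilde u\in V(H_1)$, then $d(u,\tilde u)=d(\varphi(u),\varphi(\tilde u))$; (b) if $\tilde u\in V(H_2)$, then $d(u,\tilde u)=d(\varphi(u),\varphi^{ -1}(\tilde u))$; (c) if $\tilde u\notin V(H_1)\cup V(H_2)$, then $d(u,\tilde u)=d(\varphi(u),\tilde u)$.
   Context: All graphs are finite, undirected, without loops or parallel edges. For a vertex $u$, $\mathcal{N}(u)$ denotes the set of vertices adjacent to $u$. Two induced subgraphs $H_1,H_2$ of $\mathcal{G}$ with vertex sets $V_1,V_2$ are called F-twins if there is a graph isomorphism $\varphi:V_1\to V_2$ between $H_1$ and $H_2$ such that $\mathcal{N}(u)-V_1=\mathcal{N}(\varphi(u))-V_2$ for all $u\in V_1$ (such $\varphi$ is said to witness the F-twin relation). $d(u,v)$ denotes the length of a shortest path in $\mathcal{G}$ joining $u$ and $v$. -}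

module Defs where

open import Level using (0ℓ)
open import Data.Nat using (ℕ; zero; suc; _≤_)
open import Data.Fin using (Fin)
open import Data.Product using (Σ; ∃; _×_)
open import Relation.Nullary using (¬_; Dec)
open import Relation.Binary.PropositionalEquality using (_≡_; _≢_)
open import Function.Bundles using (_⇔_)
open import Function.Definitions using (Injective)

record Graph (n : ℕ) : Set₁ where
  field
    Adj     : Fin n → Fin n → Set
    adj?    : ∀ u v → Dec (Adj u v)
    sym     : ∀ {u v} → Adj u v → Adj v u
    irrefl  : ∀ u → ¬ Adj u u

open Graph public

data Walk {n : ℕ} (G : Graph n) : Fin n → Fin n → ℕ → Set where
  here : ∀ {u} → Walk G u u zero
  step : ∀ {u w v k} → Adj G u w → Walk G w v k → Walk G u v (suc k)

Connected : ∀ {n} → Graph n → Set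
Connected G = ∀ u v → ∃ λ k → Walk G u v k

Dist : ∀ {n} → Graph n → Fin n → Fin n → ℕ → Set
Dist G u v k = Walk G u v k × (∀ m → Walk G u v m → k ≤ m)

-- d(a,b) = d(c,d)  (both sides defined in a connected graph)
SameDist : ∀ {n} → Graph n → Fin n → Fin n → Fin n → Fin n → Set
SameDist G a b c d = ∀ k → Dist G a b k ⇔ Dist G c d k

-- Membership in the vertex set of an induced subgraph given by an
-- injective enumeration f : Fin m → Fin n of its vertices.
_∈Im_ : ∀ {m n} → Fin n → (Fin m → Fin n) → Set
w ∈Im f = ∃ λ i → f i ≡ w

-- H₁, H₂ induced subgraphs with vertex sets Im f₁, Im f₂, and
-- φ : f₁ i ↦ f₂ i.
record FTwins {m n : ℕ} (G : Graph n) (f₁ f₂ : Fin m → Fin n) : Set where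
  field
    inj₁   : Injective _≡_ _≡_ f₁
    inj₂   : Injective _≡_ _≡_ f₂
    iso    : ∀ i j → Adj G (f₁ i) (f₁ j) ⇔ Adj G (f₂ i) (f₂ j)
    twin   : ∀ i w → (Adj G (f₁ i) w × ¬ (w ∈Im f₁))
                   ⇔ (Adj G (f₂ i) w × ¬ (w ∈Im f₂))

module Submission where

open import Defs
open import Data.Nat using (ℕ)
open import Data.Fin using (Fin)
open import Data.Fin.Properties using (any?; _≟_)
open import Data.Product using (Σ; _×_; _,_; proj₁; proj₂)
open import Data.Empty using (⊥-elim)
open import Relation.Nullary using (¬_; yes; no)
open import Relation.Binary.Core using (Rel)
open import Relation.Binary.Definitions using (Symmetric)
open import Relation.Binary.Rewriting using (Deterministic)
open import Relation.Binary.PropositionalEquality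
  using (_≡_; _≢_; refl; cong) renaming (sym to ≡-sym)
open import Function.Bundles using (Equivalence; mk⇔)

-- The swap f₁ i ↔ f₂ i, identity off V₁ ∪ V₂, is a graph automorphism: the
-- F-twin condition forbids edges between V₁ and V₂ and matches the outside
-- neighbours, and φ matches the inside ones. Automorphisms carry walks to walks
-- of the same length in both directions, hence preserve distances. The swap is handled as a relation, single-valued by disjointness.

module _ {n : ℕ} (G : Graph n) where

  AdjacencySimulation : Rel (Fin n) _ → Set
  AdjacencySimulation R =
    ∀ {a a' b} → R a a' → Adj G a b → Σ (Fin n) λ b' → R b b' × Adj G a' b'

  module _ {R : Rel (Fin n) _} (deterministic : Deterministic _≡_ R)
           (simulation : AdjacencySimulation R) where

    walk-transport : ∀ {a a' b b' k} → R a a' → R b b' → Walk G a b k → Walk G a' b' k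
    walk-transport ra rb here with deterministic ra rb
    ... | refl = here
    walk-transport ra rb (step a~c w) with simulation ra a~c
    ... | c' , rc , a'~c' = step a'~c' (walk-transport rc rb w)

    module _ (symmetric : Symmetric R) where

      sameDist-transport : ∀ {a a' b b'} → R a a' → R b b' → SameDist G a b a' b'
      sameDist-transport {a} {a'} {b} {b'} ra rb k = mk⇔
        (λ (w , min) → forth w , λ m w' → min m (back w'))
        (λ (w , min) → back w , λ m w' → min m (forth w'))
        where
        forth : ∀ {k} → Walk G a b k → Walk G a' b' k
        forth = walk-transport ra rb
        back : ∀ {k} → Walk G a' b' k → Walk G a b k
        back = walk-transport (symmetric ra) (symmetric rb)

module TwinSwap {m n} {G : Graph n} {f₁ f₂ : Fin m → Fin n} (T : FTwins G f₁ f₂)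
                (disjoint : ∀ i j → f₁ i ≢ f₂ j) where
  open FTwins T
  open Equivalence

  data Swap (a a' : Fin n) : Set where
    forward  : ∀ i → a ≡ f₁ i → a' ≡ f₂ i → Swap a a'
    backward : ∀ i → a ≡ f₂ i → a' ≡ f₁ i → Swap a a'
    outside  : a' ≡ a → ¬ a ∈Im f₁ → ¬ a ∈Im f₂ → Swap a a'

  data Position (b : Fin n) : Set where
    in₁     : ∀ j → f₁ j ≡ b → Position b
    in₂     : ∀ j → f₂ j ≡ b → Position b
    outside : ¬ b ∈Im f₁ → ¬ b ∈Im f₂ → Position b

  position : ∀ b → Position b
  position b with any? (λ j → f₁ j ≟ b) | any? (λ j → f₂ j ≟ b)
  ... | yes (j , e) | _           = in₁ j e
  ... | no _        | yes (j , e) = in₂ j e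
  ... | no b∉₁      | no b∉₂      = outside b∉₁ b∉₂

  swap-sym : Symmetric Swap
  swap-sym (forward i p q)  = backward i q p
  swap-sym (backward i p q) = forward i q p
  swap-sym (outside refl p q) = outside refl p q

  swap-deterministic : Deterministic _≡_ Swap
  swap-deterministic (forward i refl refl) (forward j e refl)  = cong f₂ (inj₁ e)
  swap-deterministic (forward i refl refl) (backward j e refl) = ⊥-elim (disjoint i j e)
  swap-deterministic (forward i refl refl) (outside refl p q)  = ⊥-elim (p (i , refl))
  swap-deterministic (backward i refl refl) (forward j e refl) = ⊥-elim (disjoint j i (≡-sym e))
  swap-deterministic (backward i refl refl) (backward j e refl) = cong f₁ (inj₂ e)
  swap-deterministic (backward i refl refl) (outside refl p q) = ⊥-elim (q (i , refl))
  swap-deterministic (outside refl p q) (forward j e refl)  = ⊥-elim (p (j , ≡-sym e))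
  swap-deterministic (outside refl p q) (backward j e refl) = ⊥-elim (q (j , ≡-sym e))
  swap-deterministic (outside refl p q) (outside refl _ _)  = refl

  -- An edge f₁ i — f₂ j would leave V₁ at f₁ i, so f₂ i would need the same
  -- neighbour f₂ j outside V₂.
  no-edge₁₂ : ∀ i j → ¬ Adj G (f₁ i) (f₂ j)
  no-edge₁₂ i j e = proj₂ (to (twin i (f₂ j)) (e , λ (k , p) → disjoint k j p)) (j , refl)

  no-edge₂₁ : ∀ i j → ¬ Adj G (f₂ i) (f₁ j)
  no-edge₂₁ i j e = proj₂ (from (twin i (f₁ j)) (e , λ (k , p) → disjoint j k (≡-sym p))) (j , refl)

  swap-simulation : AdjacencySimulation G Swap
  swap-simulation {b = b} (forward i refl refl) e with position b
  ... | in₁ j refl = f₂ j , forward j refl refl , to (iso i j) e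
  ... | in₂ j refl = ⊥-elim (no-edge₁₂ i j e)
  ... | outside p q = b , outside refl p q , proj₁ (to (twin i b) (e , p))
  swap-simulation {b = b} (backward i refl refl) e with position b
  ... | in₁ j refl = ⊥-elim (no-edge₂₁ i j e)
  ... | in₂ j refl = f₁ j , backward j refl refl , from (iso i j) e
  ... | outside p q = b , outside refl p q , proj₁ (from (twin i b) (e , q))
  swap-simulation {a = a} {b = b} (outside refl p q) e with position b
  ... | in₁ j refl = f₂ j , forward j refl refl
                   , Graph.sym G (proj₁ (to (twin j a) (Graph.sym G e , p)))
  ... | in₂ j refl = f₁ j , backward j refl refl
                   , Graph.sym G (proj₁ (from (twin j a) (Graph.sym G e , q)))
  ... | outside p' q' = b , outside refl p' q' , e

  swap-sameDist : ∀ {a a' b b'} → Swap a a' → Swap b b' → SameDist G a b a' b'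
  swap-sameDist = sameDist-transport G swap-deterministic swap-simulation swap-sym

proposition4 : ∀ {m n : ℕ} (G : Graph n) → Connected G →
    (f₁ f₂ : Fin m → Fin n) → FTwins G f₁ f₂ →
    (∀ i j → f₁ i ≢ f₂ j) →
    (i : Fin m) →
      ((j : Fin m) → f₁ j ≢ f₁ i → SameDist G (f₁ i) (f₁ j) (f₂ i) (f₂ j))
    × ((j : Fin m) → f₂ j ≢ f₁ i → SameDist G (f₁ i) (f₂ j) (f₂ i) (f₁ j))
    × ((w : Fin n) → w ≢ f₁ i → ¬ (w ∈Im f₁) → ¬ (w ∈Im f₂) →
         SameDist G (f₁ i) w (f₂ i) w)
proposition4 G _ f₁ f₂ T disjoint i =
    (λ j _ → swap-sameDist φ (forward j refl refl))
  , (λ j _ → swap-sameDist φ (backward j refl refl))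
  , (λ w _ w∉₁ w∉₂ → swap-sameDist φ (outside refl w∉₁ w∉₂))
  where
  open TwinSwap T disjoint
  φ : Swap (f₁ i) (f₂ i)
  φ = forward i refl refl
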